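{- Let $\pi$ be a Cayley permutation. Then $\pi$ avoids both patterns $211$ and $312$ if and only if every letter of the vertical insertion encoding of $\pi$ is of the form $a_{1,j}$ with $a \in \{\ell, m, r, f\}$ and $j \in \{0,1\}$ (i.e. every insertion in the vertical evolution of $\pi$ is made into the first (leftmost) slot of the current configuration).
   Context: A Cayley permutation is a word $\pi=\pi_1\cdots\pi_n$ over the positive integers such that every integer between $1$ and $\max \pi$ occurs at least once. The standardisation of a word replaces the occurrences of its smallest value by $1$, the next smallest by $2$, etc. A Cayley permutation $w$ contains a pattern $p=p_1\cdots p_k$ if some subsequence $w_{i_1}\cdots w_{i_k}$ ($i_1<\dots<i_k$) standardises to $p$; otherwise $w$ avoids $p$. Vertical evolution and encoding: a Cayley permutation is built from the empty word by inserting its entries in increasing order of value, and among entries of equal value from left to right. A configuration is a word over the positive integers and a slot symbol $\diamond$, recording the entries placed so far in their relative positions, with one slot $\diamond$ for each maximal block of consecutive positions still to be filled; the evolution starts with the configuration $\diamond$. Slots are indexed $1,2,\dots$ from left to right. Inserting a value $n$ into slot $i$ replaces that slot by one of: $n\diamond$ (letter $\ell$), $\diamond n \diamond$ (letter $m$), $\diamond n$ (letter $r$), or $n$ (letter $f$). Each insertion is recorded by the letter $a_{i,j}$ where $a\in\{\ell,m,r,f\}$ is the type, $i$ the index of the slot, and $j=1$ if $n$ is a new maximum (larger than all values placed so far) and $j=0$ if $n$ equals the current maximum value (a repeated value). The vertical insertion encoding of $\pi$ is the word of letters recorded along its (unique) evolution. -}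

module Defs where

open import Data.Nat.Base using (ℕ; zero; suc; _+_; _∸_; _≤_; _⊔_; _≡ᵇ_; _<ᵇ_; _≤ᵇ_)
open import Data.Bool.Base using (Bool; true; false; not; _∧_; if_then_else_)
open import Data.List.Base using (List; []; _∷_; length; filter; map; foldr; upTo; concatMap; deduplicateᵇ; _++_)
open import Data.List.Relation.Unary.All using (All)
open import Data.List.Membership.Propositional using (_∈_)
open import Data.List.Relation.Binary.Sublist.Propositional using (_⊆_)
open import Data.Product.Base using (Σ; _×_)
open import Relation.Binary.PropositionalEquality using (_≡_)
open import Relation.Nullary using (¬_)
open import Relation.Nullary.Decidable using (T?)
open import Data.Bool.Base using (T)

Word : Set
Word = List ℕ

maxW : Word → ℕ
maxW = foldr _⊔_ 0

IsCayley : Word → Set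
IsCayley π = All (λ x → 1 ≤ x) π × (∀ k → 1 ≤ k → k ≤ maxW π → k ∈ π)

std : Word → Word
std w = map (λ x → length (filter (λ y → T? (y ≤ᵇ x)) (deduplicateᵇ _≡ᵇ_ w))) w

Contains : Word → Word → Set
Contains w p = Σ Word (λ s → (s ⊆ w) × (std s ≡ p))

Avoids : Word → Word → Set
Avoids w p = ¬ Contains w p

data Kind : Set where
  ℓ m r f : Kind

record Letter : Set where
  constructor a[_,_,_]
  field
    kind : Kind
    slot : ℕ   -- i : index of the slot (1-based, left to right)
    new  : ℕ   -- j : 1 if the inserted value is a new maximum, 0 otherwise
open Letter public

-- filled-status of positions (true = filled); out of range counts as filled
at : List Bool → ℕ → Bool
at []       _       = true
at (b ∷ bs) zero    = b
at (b ∷ bs) (suc q) = at bs q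

atLeft : List Bool → ℕ → Bool
atLeft fs zero    = true
atLeft fs (suc q) = at fs q

setFilled : List Bool → ℕ → List Bool
setFilled []       _       = []
setFilled (b ∷ bs) zero    = true ∷ bs
setFilled (b ∷ bs) (suc q) = b ∷ setFilled bs q

-- position q begins a maximal block of unfilled positions (a slot)
slotStart : List Bool → ℕ → Bool
slotStart fs q = not (at fs q) ∧ atLeft fs q

slotIndex : List Bool → ℕ → ℕ
slotIndex fs p = length (filter (λ q → T? (slotStart fs q)) (upTo (suc p)))

-- type of insertion at position p: ℓ = n◇, m = ◇n◇, r = ◇n, f = n
kindAt : List Bool → ℕ → Kind
kindAt fs p with atLeft fs p | at fs (suc p)
... | true  | true  = f
... | true  | false = ℓ
... | false | true  = r
... | false | false = m

-- entry of a word at a position (0 if out of range; not used then)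
entry : Word → ℕ → ℕ
entry []       _       = 0
entry (x ∷ xs) zero    = x
entry (x ∷ xs) (suc q) = entry xs q

insertionOrder : Word → List ℕ
insertionOrder π =
  concatMap (λ v → filter (λ i → T? (entry π i ≡ᵇ v)) (upTo (length π)))
            (map suc (upTo (maxW π)))

-- run the vertical evolution; fs = filled status, mx = current maximum value
evolve : Word → List Bool → ℕ → List ℕ → List Letter
evolve π fs mx []       = []
evolve π fs mx (p ∷ ps) =
  a[ kindAt fs p , slotIndex fs p , (if mx <ᵇ entry π p then 1 else 0) ]
  ∷ evolve π (setFilled fs p) (mx ⊔ entry π p) ps

vie : Word → List Letter
vie π = evolve π (map (λ _ → false) π) 0 (insertionOrder π)

-- Entries are inserted by increasing value, ties left to right. So when position p is filled,
-- a position q < p is already filled iff π_q ≤ π_p, and still open iff π_q > π_p. Position p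
-- lies in the first slot iff no filled position to its left follows an open one, i.e. iff
-- there are no u < q < p with π_q ≤ π_p < π_u; and such a triple is precisely an occurrence
-- of 211 (π_q = π_p) or of 312 (π_q < π_p).
module Submission where

open import Defs
open import Data.Nat.Base using (ℕ; zero; suc; _≤_; _<_; _≤ᵇ_; _≡ᵇ_; z≤n; s≤s; s≤s⁻¹)
open import Data.Nat.Properties
open import Data.Bool.Base using (Bool; true; false; not; T; _∧_)
open import Data.List.Base using (List; []; _∷_; length; filter; map; upTo; concatMap; deduplicateᵇ)
open import Data.List.Relation.Unary.Any using (Any; here; there)
import Data.List.Relation.Unary.Any as Any
open import Data.List.Relation.Unary.All using (All; []; _∷_)
import Data.List.Relation.Unary.All as All
import Data.List.Relation.Unary.All.Properties as Allₚ
open import Data.List.Relation.Unary.AllPairs using (AllPairs; []; _∷_)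
import Data.List.Relation.Unary.AllPairs as AllPairs
import Data.List.Relation.Unary.AllPairs.Properties as AllPairsₚ
open import Data.List.Membership.Propositional using (_∈_)
open import Data.List.Membership.Propositional.Properties
  using (∈-upTo⁺; ∈-upTo⁻; ∈-filter⁺; ∈-filter⁻; ∈-map⁺; ∈-concatMap⁺; ∈-concatMap⁻)
import Data.List.Membership.Setoid.Properties as SetoidMembership
open import Data.List.Relation.Binary.Sublist.Propositional using (_⊆_; _∷_; _∷ʳ_; minimum)
open import Data.Product.Base using (Σ; _×_; _,_; proj₁; proj₂)
open import Data.Sum.Base using (_⊎_; inj₁; inj₂; [_,_])
open import Data.Empty using (⊥-elim)
open import Function.Base using (_∘_)
open import Function.Bundles using (_⇔_; mk⇔)
import Function.Properties.Equivalence as ⇔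
open import Relation.Binary.PropositionalEquality
  using (_≡_; _≢_; refl; sym; trans; cong; cong₂; subst; setoid)
open import Relation.Nullary using (¬_; yes; no)
open import Relation.Nullary.Decidable using (T?)

true≢false : ∀ {b : Bool} → b ≡ true → b ≢ false
true≢false refl ()

T⇒≡true : ∀ {b} → T b → b ≡ true
T⇒≡true {true} _ = refl

¬T⇒≡false : ∀ {b} → ¬ T b → b ≡ false
¬T⇒≡false {false} _ = refl
¬T⇒≡false {true} ¬t = ⊥-elim (¬t _)

≤ᵇ-true : ∀ {a b} → a ≤ b → (a ≤ᵇ b) ≡ true
≤ᵇ-true a≤b = T⇒≡true (≤⇒≤ᵇ a≤b)

≤ᵇ≡true⇒≤ : ∀ a b → (a ≤ᵇ b) ≡ true → a ≤ b
≤ᵇ≡true⇒≤ a b a≤ᵇb = ≤ᵇ⇒≤ a b (subst T (sym a≤ᵇb) _)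

≤ᵇ-false : ∀ {a b} → b < a → (a ≤ᵇ b) ≡ false
≤ᵇ-false {a} {b} b<a = ¬T⇒≡false (λ t → <⇒≱ b<a (≤ᵇ⇒≤ a b t))

≡ᵇ-refl : ∀ a → (a ≡ᵇ a) ≡ true
≡ᵇ-refl a = T⇒≡true (≡⇒≡ᵇ a a refl)

≡ᵇ-false : ∀ {a b} → a ≢ b → (a ≡ᵇ b) ≡ false
≡ᵇ-false {a} {b} a≢b = ¬T⇒≡false (λ t → a≢b (≡ᵇ⇒≡ a b t))

dedup : Word → Word
dedup = deduplicateᵇ _≡ᵇ_

∈-dedup : ∀ {x xs} → x ∈ xs → x ∈ dedup xs
∈-dedup = SetoidMembership.∈-deduplicate⁺ (setoid ℕ) (λ x y → T? (x ≡ᵇ y))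
  λ {_} {y} {z} z≡ᵇy x≡y → trans x≡y (sym (≡ᵇ⇒≡ z y z≡ᵇy))

-- Definitionally, std w is map (rank (dedup w)) w.
rank : Word → ℕ → ℕ
rank D x = length (filter (λ y → T? (y ≤ᵇ x)) D)

rank-mono : ∀ D {x y} → x ≤ y → rank D x ≤ rank D y
rank-mono [] x≤y = z≤n
rank-mono (a ∷ D) {x} {y} x≤y with a ≤ᵇ x in a≤ᵇx | a ≤ᵇ y in a≤ᵇy
... | true  | true  = s≤s (rank-mono D x≤y)
... | false | false = rank-mono D x≤y
... | false | true  = m≤n⇒m≤1+n (rank-mono D x≤y)
... | true  | false = ⊥-elim (true≢false (≤ᵇ-true (≤-trans (≤ᵇ≡true⇒≤ a x a≤ᵇx) x≤y)) a≤ᵇy)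

rank-mono-< : ∀ D {x y} → x < y → y ∈ D → rank D x < rank D y
rank-mono-< (a ∷ D) {x} {y} x<y y∈D with a ≤ᵇ x in a≤ᵇx | a ≤ᵇ y in a≤ᵇy | y∈D
... | true  | _     | here refl = ⊥-elim (<⇒≱ x<y (≤ᵇ≡true⇒≤ a x a≤ᵇx))
... | false | false | here refl = ⊥-elim (true≢false (≤ᵇ-true (≤-refl {a})) a≤ᵇy)
... | false | true  | here refl = s≤s (rank-mono D (<⇒≤ x<y))
... | true  | true  | there y∈D′ = s≤s (rank-mono-< D x<y y∈D′)
... | false | false | there y∈D′ = rank-mono-< D x<y y∈D′
... | false | true  | there y∈D′ = m≤n⇒m≤1+n (rank-mono-< D x<y y∈D′)
... | true  | false | there _    =
  ⊥-elim (true≢false (≤ᵇ-true (≤-trans (≤ᵇ≡true⇒≤ a x a≤ᵇx) (<⇒≤ x<y))) a≤ᵇy)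

-- Each rewrite must expose the next comparison on which a filter in std is stuck.
std-211 : ∀ {x y} → y < x → std (x ∷ y ∷ y ∷ []) ≡ 2 ∷ 1 ∷ 1 ∷ []
std-211 {x} {y} y<x
  rewrite ≡ᵇ-refl y | ≡ᵇ-false (>⇒≢ y<x) | ≤ᵇ-false y<x
        | ≤ᵇ-true (≤-refl {x}) | ≤ᵇ-true (≤-refl {y}) | ≤ᵇ-true (<⇒≤ y<x) = refl

std-312 : ∀ {x y z} → y < z → z < x → std (x ∷ y ∷ z ∷ []) ≡ 3 ∷ 1 ∷ 2 ∷ []
std-312 {x} {y} {z} y<z z<x
  with y<x ← <-trans y<z z<x
  rewrite ≡ᵇ-false (<⇒≢ y<z) | ≡ᵇ-false (>⇒≢ y<x) | ≡ᵇ-false (>⇒≢ z<x)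
        | ≤ᵇ-true (≤-refl {x}) | ≤ᵇ-true (<⇒≤ y<x) | ≤ᵇ-true (<⇒≤ z<x)
        | ≤ᵇ-false y<x | ≤ᵇ-true (≤-refl {y}) | ≤ᵇ-false y<z
        | ≤ᵇ-false z<x | ≤ᵇ-true (<⇒≤ y<z) | ≤ᵇ-true (≤-refl {z}) = refl

std-reflects-≤< : ∀ {x y z a b c} → std (x ∷ y ∷ z ∷ []) ≡ a ∷ b ∷ c ∷ [] →
                  b ≤ c → c < a → y ≤ z × z < x
std-reflects-≤< {x} {y} {z} refl b≤c c<a = y≤z , z<x
  where
  D = dedup (x ∷ y ∷ z ∷ [])
  y≤z : y ≤ z
  y≤z with y ≤? z
  ... | yes y≤z = y≤z
  ... | no y≰z =
    ⊥-elim (<⇒≱ (rank-mono-< D (≰⇒> y≰z) (∈-dedup {xs = x ∷ y ∷ z ∷ []} (there (here refl)))) b≤c)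
  z<x : z < x
  z<x with x ≤? z
  ... | yes x≤z = ⊥-elim (<⇒≱ c<a (rank-mono D x≤z))
  ... | no x≰z = ≰⇒> x≰z

EntryAt : Word → ℕ → Set
EntryAt ys z = Σ ℕ λ p → p < length ys × entry ys p ≡ z

EntriesAt₂ : Word → ℕ → ℕ → Set
EntriesAt₂ ys y z = Σ ℕ λ q → Σ ℕ λ p → q < p × p < length ys × entry ys q ≡ y × entry ys p ≡ z

EntriesAt₃ : Word → ℕ → ℕ → ℕ → Set
EntriesAt₃ ys x y z = Σ ℕ λ u → Σ ℕ λ q → Σ ℕ λ p → u < q × q < p × p < length ys ×
                      entry ys u ≡ x × entry ys q ≡ y × entry ys p ≡ z

⊆⇒entryAt : ∀ {z xs ys} → (z ∷ xs) ⊆ ys → EntryAt ys z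
⊆⇒entryAt (_ ∷ʳ sub) with ⊆⇒entryAt sub
... | p , p<n , ≡z = suc p , s≤s p<n , ≡z
⊆⇒entryAt (refl ∷ _) = 0 , s≤s z≤n , refl

⊆⇒entriesAt₂ : ∀ {y z xs ys} → (y ∷ z ∷ xs) ⊆ ys → EntriesAt₂ ys y z
⊆⇒entriesAt₂ (_ ∷ʳ sub) with ⊆⇒entriesAt₂ sub
... | q , p , q<p , p<n , ≡y , ≡z = suc q , suc p , s≤s q<p , s≤s p<n , ≡y , ≡z
⊆⇒entriesAt₂ (refl ∷ sub) with ⊆⇒entryAt sub
... | p , p<n , ≡z = 0 , suc p , s≤s z≤n , s≤s p<n , refl , ≡z

⊆⇒entriesAt₃ : ∀ {x y z xs ys} → (x ∷ y ∷ z ∷ xs) ⊆ ys → EntriesAt₃ ys x y z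
⊆⇒entriesAt₃ (_ ∷ʳ sub) with ⊆⇒entriesAt₃ sub
... | u , q , p , u<q , q<p , p<n , ≡x , ≡y , ≡z =
  suc u , suc q , suc p , s≤s u<q , s≤s q<p , s≤s p<n , ≡x , ≡y , ≡z
⊆⇒entriesAt₃ (refl ∷ sub) with ⊆⇒entriesAt₂ sub
... | q , p , q<p , p<n , ≡y , ≡z = 0 , suc q , suc p , s≤s z≤n , s≤s q<p , s≤s p<n , refl , ≡y , ≡z

entry-⊆ : ∀ ys p → p < length ys → (entry ys p ∷ []) ⊆ ys
entry-⊆ (y ∷ ys) zero    _         = refl ∷ minimum ys
entry-⊆ (y ∷ ys) (suc p) (s≤s p<n) = y ∷ʳ entry-⊆ ys p p<n

entries-⊆₂ : ∀ ys q p → q < p → p < length ys → (entry ys q ∷ entry ys p ∷ []) ⊆ ys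
entries-⊆₂ (y ∷ ys) zero    (suc p) _         (s≤s p<n) = refl ∷ entry-⊆ ys p p<n
entries-⊆₂ (y ∷ ys) (suc q) (suc p) (s≤s q<p) (s≤s p<n) = y ∷ʳ entries-⊆₂ ys q p q<p p<n

entries-⊆₃ : ∀ ys u q p → u < q → q < p → p < length ys →
             (entry ys u ∷ entry ys q ∷ entry ys p ∷ []) ⊆ ys
entries-⊆₃ (y ∷ ys) zero    (suc q) (suc p) _         (s≤s q<p) (s≤s p<n) =
  refl ∷ entries-⊆₂ ys q p q<p p<n
entries-⊆₃ (y ∷ ys) (suc u) (suc q) (suc p) (s≤s u<q) (s≤s q<p) (s≤s p<n) =
  y ∷ʳ entries-⊆₃ ys u q p u<q q<p p<n

ObstructionAt : Word → ℕ → Set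
ObstructionAt π p = Σ ℕ λ u → Σ ℕ λ q → u < q × q < p × entry π q ≤ entry π p × entry π p < entry π u

Obstruction : Word → Set
Obstruction π = Σ ℕ λ p → p < length π × ObstructionAt π p

contains⇒obstruction : ∀ π {a b c} → b ≤ c → c < a → Contains π (a ∷ b ∷ c ∷ []) → Obstruction π
contains⇒obstruction π b≤c c<a ((x ∷ y ∷ z ∷ []) , sub , std≡)
  with std-reflects-≤< {x} {y} {z} std≡ b≤c c<a | ⊆⇒entriesAt₃ sub
... | y≤z , z<x | u , q , p , u<q , q<p , p<n , refl , refl , refl = p , p<n , u , q , u<q , q<p , y≤z , z<x

obstruction⇒contains : ∀ π → Obstruction π → Contains π (2 ∷ 1 ∷ 1 ∷ []) ⊎ Contains π (3 ∷ 1 ∷ 2 ∷ [])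
obstruction⇒contains π (p , p<n , u , q , u<q , q<p , πq≤πp , πp<πu)
  with occurrence ← entries-⊆₃ π u q p u<q q<p p<n | m≤n⇒m<n∨m≡n πq≤πp
... | inj₁ πq<πp = inj₂ (_ , occurrence , std-312 πq<πp πp<πu)
... | inj₂ πq≡πp rewrite πq≡πp = inj₁ (_ , occurrence , std-211 πp<πu)

avoids⇔¬obstruction : ∀ π → (Avoids π (2 ∷ 1 ∷ 1 ∷ []) × Avoids π (3 ∷ 1 ∷ 2 ∷ [])) ⇔ (¬ Obstruction π)
avoids⇔¬obstruction π = mk⇔
  (λ (avoids211 , avoids312) obstruction → [ avoids211 , avoids312 ] (obstruction⇒contains π obstruction))
  (λ noObstruction → (noObstruction ∘ contains⇒obstruction π ≤-refl ≤-refl)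
                   , (noObstruction ∘ contains⇒obstruction π (n≤1+n 1) ≤-refl))

module _ {A : Set} (g : A → Bool) where

  countᵇ : List A → ℕ
  countᵇ xs = length (filter (λ x → T? (g x)) xs)

  countᵇ-≥1 : ∀ {a} xs → a ∈ xs → g a ≡ true → 1 ≤ countᵇ xs
  countᵇ-≥1 (x ∷ xs) (here refl) ga rewrite ga = s≤s z≤n
  countᵇ-≥1 (x ∷ xs) (there a∈xs) ga with g x
  ... | true  = s≤s z≤n
  ... | false = countᵇ-≥1 xs a∈xs ga

  countᵇ-≥2 : ∀ {a b} xs → a ≢ b → a ∈ xs → b ∈ xs → g a ≡ true → g b ≡ true → 2 ≤ countᵇ xs
  countᵇ-≥2 (x ∷ xs) a≢b (here refl) (here refl) ga gb = ⊥-elim (a≢b refl)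
  countᵇ-≥2 (x ∷ xs) a≢b (here refl) (there b∈xs) ga gb rewrite ga = s≤s (countᵇ-≥1 xs b∈xs gb)
  countᵇ-≥2 (x ∷ xs) a≢b (there a∈xs) (here refl) ga gb rewrite gb = s≤s (countᵇ-≥1 xs a∈xs ga)
  countᵇ-≥2 (x ∷ xs) a≢b (there a∈xs) (there b∈xs) ga gb with g x
  ... | true  = m≤n⇒m≤1+n (countᵇ-≥2 xs a≢b a∈xs b∈xs ga gb)
  ... | false = countᵇ-≥2 xs a≢b a∈xs b∈xs ga gb

  countᵇ-≥1⁻ : ∀ xs → 1 ≤ countᵇ xs → Σ A λ b → b ∈ xs × g b ≡ true
  countᵇ-≥1⁻ (x ∷ xs) 1≤c with g x in gx
  ... | true = x , here refl , gx
  ... | false with countᵇ-≥1⁻ xs 1≤c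
  ... | b , b∈xs , gb = b , there b∈xs , gb

  countᵇ-≥2⁻ : ∀ {R : A → A → Set} xs → AllPairs R xs → 2 ≤ countᵇ xs →
               Σ A λ a → Σ A λ b → R a b × a ∈ xs × b ∈ xs × g a ≡ true × g b ≡ true
  countᵇ-≥2⁻ (x ∷ xs) (Rx ∷ Rxs) 2≤c with g x in gx
  ... | true with countᵇ-≥1⁻ xs (s≤s⁻¹ 2≤c)
  ... | b , b∈xs , gb = x , b , All.lookup Rx b∈xs , here refl , there b∈xs , gx , gb
  countᵇ-≥2⁻ (x ∷ xs) (_ ∷ Rxs) 2≤c | false with countᵇ-≥2⁻ xs Rxs 2≤c
  ... | a , b , Rab , a∈xs , b∈xs , ga , gb = a , b , Rab , there a∈xs , there b∈xs , ga , gb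

slotStart⁻ : ∀ fs s → slotStart fs s ≡ true → at fs s ≡ false × atLeft fs s ≡ true
slotStart⁻ fs s start with at fs s | atLeft fs s
... | false | true = refl , refl

slotStart-≤ : ∀ fs u → at fs u ≡ false → Σ ℕ λ s → s ≤ u × slotStart fs s ≡ true
slotStart-≤ fs zero    u-open = 0 , z≤n , cong (λ b → not b ∧ true) u-open
slotStart-≤ fs (suc u) u-open with at fs u in left
... | true  = suc u , ≤-refl , cong₂ (λ b c → not b ∧ c) u-open left
... | false with slotStart-≤ fs u left
... | s , s≤u , start = s , m≤n⇒m≤1+n s≤u , start

slotStart-between : ∀ fs q p → q < p → at fs q ≡ true → at fs p ≡ false →
                    Σ ℕ λ s → q < s × s ≤ p × slotStart fs s ≡ true
slotStart-between fs q (suc p) (s≤s q≤p) q-filled p-open with at fs p in left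
... | true = suc p , s≤s q≤p , ≤-refl , cong₂ (λ b c → not b ∧ c) p-open left
... | false with m≤n⇒m<n∨m≡n q≤p
... | inj₂ refl = ⊥-elim (true≢false q-filled left)
... | inj₁ q<p with slotStart-between fs q p q<p q-filled left
... | s , q<s , s≤p , start = s , q<s , m≤n⇒m≤1+n s≤p , start

upTo-increasing : ∀ n → AllPairs _<_ (upTo n)
upTo-increasing n = AllPairsₚ.applyUpTo⁺₁ (λ x → x) n (λ i<j _ → i<j)

HoleThenFilled : List Bool → ℕ → Set
HoleThenFilled fs p = Σ ℕ λ u → Σ ℕ λ q → u < q × q < p × at fs u ≡ false × at fs q ≡ true

slotIndex≡1⇒¬holeThenFilled : ∀ fs p → at fs p ≡ false → slotIndex fs p ≡ 1 → ¬ HoleThenFilled fs p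
slotIndex≡1⇒¬holeThenFilled fs p p-open index≡1 (u , q , u<q , q<p , u-open , q-filled)
  with slotStart-≤ fs u u-open | slotStart-between fs q p q<p q-filled p-open
... | s , s≤u , start | s′ , q<s′ , s′≤p , start′ = <-irrefl refl (subst (2 ≤_) index≡1 two-starts)
  where
  s<s′ : s < s′
  s<s′ = ≤-<-trans s≤u (<-trans u<q q<s′)
  two-starts : 2 ≤ slotIndex fs p
  two-starts = countᵇ-≥2 (slotStart fs) (upTo (suc p)) (<⇒≢ s<s′)
                 (∈-upTo⁺ (s≤s (≤-trans (<⇒≤ s<s′) s′≤p))) (∈-upTo⁺ (s≤s s′≤p)) start start′

¬holeThenFilled⇒slotIndex≡1 : ∀ fs p → at fs p ≡ false → ¬ HoleThenFilled fs p → slotIndex fs p ≡ 1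
¬holeThenFilled⇒slotIndex≡1 fs p p-open noHole with slotIndex fs p in index
... | zero with slotStart-≤ fs p p-open
... | s , s≤p , start =
  ⊥-elim (<-irrefl refl
    (subst (1 ≤_) index (countᵇ-≥1 (slotStart fs) (upTo (suc p)) (∈-upTo⁺ (s≤s s≤p)) start)))
¬holeThenFilled⇒slotIndex≡1 fs p p-open noHole | suc zero = refl
¬holeThenFilled⇒slotIndex≡1 fs p p-open noHole | suc (suc _)
  with countᵇ-≥2⁻ (slotStart fs) (upTo (suc p)) (upTo-increasing (suc p))
                   (subst (2 ≤_) (sym index) (s≤s (s≤s z≤n)))
... | a , suc b , s≤s a≤b , _ , b+1∈ , startA , startB
  with slotStart⁻ fs a startA | slotStart⁻ fs (suc b) startB | m≤n⇒m<n∨m≡n a≤b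
... | a-open , _ | _ , b-filled | inj₂ refl = ⊥-elim (true≢false b-filled a-open)
... | a-open , _ | _ , b-filled | inj₁ a<b =
  ⊥-elim (noHole (a , b , a<b , s≤s⁻¹ (∈-upTo⁻ b+1∈) , a-open , b-filled))

at-setFilled-≡ : ∀ fs p → at (setFilled fs p) p ≡ true
at-setFilled-≡ []       p       = refl
at-setFilled-≡ (b ∷ fs) zero    = refl
at-setFilled-≡ (b ∷ fs) (suc p) = at-setFilled-≡ fs p

at-setFilled-≢ : ∀ fs p q → q ≢ p → at (setFilled fs p) q ≡ at fs q
at-setFilled-≢ []       p       q       q≢p = refl
at-setFilled-≢ (b ∷ fs) zero    zero    q≢p = ⊥-elim (q≢p refl)
at-setFilled-≢ (b ∷ fs) zero    (suc q) q≢p = refl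
at-setFilled-≢ (b ∷ fs) (suc p) zero    q≢p = refl
at-setFilled-≢ (b ∷ fs) (suc p) (suc q) q≢p = at-setFilled-≢ fs p q (q≢p ∘ cong suc)

at-allUnfilled : ∀ (π : Word) q → q < length π → at (map (λ _ → false) π) q ≡ false
at-allUnfilled (x ∷ π) zero    _         = refl
at-allUnfilled (x ∷ π) (suc q) (s≤s q<n) = at-allUnfilled π q q<n

entry-≤-maxW : ∀ π q → q < length π → entry π q ≤ maxW π
entry-≤-maxW (x ∷ π) zero    _         = m≤m⊔n x (maxW π)
entry-≤-maxW (x ∷ π) (suc q) (s≤s q<n) = ≤-trans (entry-≤-maxW π q q<n) (m≤n⊔m x (maxW π))

entry-positive : ∀ π q → All (1 ≤_) π → q < length π → 1 ≤ entry π q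
entry-positive (x ∷ π) zero    (1≤x ∷ _) _         = 1≤x
entry-positive (x ∷ π) (suc q) (_ ∷ pos) (s≤s q<n) = entry-positive π q pos q<n

module Evolution (π : Word) where

  private
    E : ℕ → ℕ
    E = entry π

    n : ℕ
    n = length π

  -- q is inserted before p in the vertical evolution.
  _≺_ : ℕ → ℕ → Set
  q ≺ p = E q < E p ⊎ (E q ≡ E p × q < p)

  ≺-irrefl : ∀ {q} → ¬ q ≺ q
  ≺-irrefl (inj₁ Eq<Eq)      = <-irrefl refl Eq<Eq
  ≺-irrefl (inj₂ (_ , q<q)) = <-irrefl refl q<q

  ≺-asym : ∀ {q p} → q ≺ p → ¬ p ≺ q
  ≺-asym (inj₁ Eq<Ep)       (inj₁ Ep<Eq)       = <-asym Eq<Ep Ep<Eq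
  ≺-asym (inj₁ Eq<Ep)       (inj₂ (Ep≡Eq , _)) = <-irrefl (sym Ep≡Eq) Eq<Ep
  ≺-asym (inj₂ (Eq≡Ep , _)) (inj₁ Ep<Eq)       = <-irrefl (sym Eq≡Ep) Ep<Eq
  ≺-asym (inj₂ (_ , q<p))   (inj₂ (_ , p<q))   = <-asym q<p p<q

  ≺⇒≤ : ∀ {q p} → q ≺ p → E q ≤ E p
  ≺⇒≤ (inj₁ Eq<Ep)       = <⇒≤ Eq<Ep
  ≺⇒≤ (inj₂ (Eq≡Ep , _)) = ≤-reflexive Eq≡Ep

  positionsOf : ℕ → List ℕ
  positionsOf v = filter (λ i → T? (E i ≡ᵇ v)) (upTo n)

  positionsOf-entry : ∀ v → All (λ i → E i ≡ v) (positionsOf v)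
  positionsOf-entry v = All.tabulate λ {i} i∈ →
    ≡ᵇ⇒≡ (E i) v (proj₂ (∈-filter⁻ (λ i → T? (E i ≡ᵇ v)) {xs = upTo n} i∈))

  positionsOf-sorted : ∀ v → AllPairs _≺_ (positionsOf v)
  positionsOf-sorted v =
    equal-values (positionsOf-entry v) (AllPairsₚ.filter⁺ (λ i → T? (E i ≡ᵇ v)) (upTo-increasing n))
    where
    equal-values : ∀ {is} → All (λ i → E i ≡ v) is → AllPairs _<_ is → AllPairs _≺_ is
    equal-values []           []           = []
    equal-values (Ei≡v ∷ Eis) (i<is ∷ <is) =
      All.zipWith (λ { (Ej≡v , i<j) → inj₂ (trans Ei≡v (sym Ej≡v) , i<j) }) (Eis , i<is)
      ∷ equal-values Eis <is

  positionsOf-above : ∀ v vs → All (v <_) vs → All (λ i → v < E i) (concatMap positionsOf vs)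
  positionsOf-above v []       []           = []
  positionsOf-above v (w ∷ vs) (v<w ∷ v<vs) =
    Allₚ.++⁺ (All.map (λ Ei≡w → subst (v <_) (sym Ei≡w) v<w) (positionsOf-entry w))
             (positionsOf-above v vs v<vs)

  concatMap-positionsOf-sorted : ∀ vs → AllPairs _<_ vs → AllPairs _≺_ (concatMap positionsOf vs)
  concatMap-positionsOf-sorted []       []           = []
  concatMap-positionsOf-sorted (v ∷ vs) (v<vs ∷ <vs) =
    AllPairsₚ.++⁺ (positionsOf-sorted v) (concatMap-positionsOf-sorted vs <vs)
      (All.map (λ Ei≡v → All.map (λ v<Ej → inj₁ (subst (_< _) (sym Ei≡v) v<Ej))
                                  (positionsOf-above v vs v<vs))
               (positionsOf-entry v))

  insertionOrder-sorted : AllPairs _≺_ (insertionOrder π)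
  insertionOrder-sorted = concatMap-positionsOf-sorted (map suc (upTo (maxW π)))
    (AllPairsₚ.map⁺ (AllPairs.map s≤s (upTo-increasing (maxW π))))

  insertionOrder-bounded : All (_< n) (insertionOrder π)
  insertionOrder-bounded = All.tabulate λ i∈ →
    bounded (∈-concatMap⁻ positionsOf {xs = map suc (upTo (maxW π))} i∈)
    where
    bounded : ∀ {i vs} → Any (λ v → i ∈ positionsOf v) vs → i < n
    bounded (here i∈)  = ∈-upTo⁻ (proj₁ (∈-filter⁻ _ i∈))
    bounded (there i∈) = bounded i∈

  insertionOrder-complete : All (1 ≤_) π → ∀ q → q < n → q ∈ insertionOrder π
  insertionOrder-complete positive q q<n =
    ∈-concatMap⁺ positionsOf (Any.map (λ Eq≡v → subst (λ v → q ∈ positionsOf v) Eq≡v q∈) value∈)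
    where
    q∈ : q ∈ positionsOf (E q)
    q∈ = ∈-filter⁺ (λ i → T? (E i ≡ᵇ E q)) (∈-upTo⁺ q<n) (≡⇒≡ᵇ (E q) (E q) refl)
    value∈ : E q ∈ map suc (upTo (maxW π))
    value∈ with E q | entry-positive π q positive q<n | entry-≤-maxW π q q<n
    ... | suc k | _ | 1+k≤max = ∈-map⁺ suc (∈-upTo⁺ 1+k≤max)

  record Invariant (fs : List Bool) (ps : List ℕ) : Set where
    field
      unfilled⇒pending : ∀ q → q < n → at fs q ≡ false → q ∈ ps
      pending⇒unfilled : ∀ q → q ∈ ps → at fs q ≡ false
      filled≺pending   : ∀ q → q < n → at fs q ≡ true → All (q ≺_) ps
      pending-sorted   : AllPairs _≺_ ps
      pending-bounded  : All (_< n) ps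
  open Invariant

  invariant-initial : All (1 ≤_) π → Invariant (map (λ _ → false) π) (insertionOrder π)
  invariant-initial positive = record
    { unfilled⇒pending = λ q q<n _ → insertionOrder-complete positive q q<n
    ; pending⇒unfilled = λ q q∈ → at-allUnfilled π q (All.lookup insertionOrder-bounded q∈)
    ; filled≺pending   = λ q q<n q-filled → ⊥-elim (true≢false q-filled (at-allUnfilled π q q<n))
    ; pending-sorted   = insertionOrder-sorted
    ; pending-bounded  = insertionOrder-bounded
    }

  invariant-step : ∀ {fs p ps} → Invariant fs (p ∷ ps) → Invariant (setFilled fs p) ps
  invariant-step {fs} {p} {ps} inv = record
    { unfilled⇒pending = unfilled⇒pending′
    ; pending⇒unfilled = pending⇒unfilled′
    ; filled≺pending   = filled≺pending′
    ; pending-sorted   = AllPairs.tail (pending-sorted inv)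
    ; pending-bounded  = All.tail (pending-bounded inv)
    }
    where
    p≺ps : All (p ≺_) ps
    p≺ps = AllPairs.head (pending-sorted inv)

    unfilled⇒pending′ : ∀ q → q < n → at (setFilled fs p) q ≡ false → q ∈ ps
    unfilled⇒pending′ q q<n q-open with q ≟ p
    ... | yes refl = ⊥-elim (true≢false (at-setFilled-≡ fs p) q-open)
    ... | no q≢p with unfilled⇒pending inv q q<n (trans (sym (at-setFilled-≢ fs p q q≢p)) q-open)
    ...   | here q≡p = ⊥-elim (q≢p q≡p)
    ...   | there q∈ps = q∈ps

    pending⇒unfilled′ : ∀ q → q ∈ ps → at (setFilled fs p) q ≡ false
    pending⇒unfilled′ q q∈ps =
      trans (at-setFilled-≢ fs p q (λ { refl → ≺-irrefl (All.lookup p≺ps q∈ps) }))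
            (pending⇒unfilled inv q (there q∈ps))

    filled≺pending′ : ∀ q → q < n → at (setFilled fs p) q ≡ true → All (q ≺_) ps
    filled≺pending′ q q<n q-filled with q ≟ p
    ... | yes refl = p≺ps
    ... | no q≢p = All.tail (filled≺pending inv q q<n (trans (sym (at-setFilled-≢ fs p q q≢p)) q-filled))

  module _ {fs p ps} (inv : Invariant fs (p ∷ ps)) where

    private
      p<n : p < n
      p<n = All.head (pending-bounded inv)

      p-open : at fs p ≡ false
      p-open = pending⇒unfilled inv p (here refl)

    filled⇒≤ : ∀ {q} → q < p → at fs q ≡ true → E q ≤ E p
    filled⇒≤ {q} q<p q-filled = ≺⇒≤ (All.head (filled≺pending inv q (<-trans q<p p<n) q-filled))

    ≤⇒filled : ∀ {q} → q < p → E q ≤ E p → at fs q ≡ true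
    ≤⇒filled {q} q<p Eq≤Ep with at fs q in q-status
    ... | true  = refl
    ... | false with unfilled⇒pending inv q (<-trans q<p p<n) q-status
    ...   | here refl  = ⊥-elim (<-irrefl refl q<p)
    ...   | there q∈ps = ⊥-elim (≺-asym (All.lookup (AllPairs.head (pending-sorted inv)) q∈ps) q≺p)
      where
      q≺p : q ≺ p
      q≺p with m≤n⇒m<n∨m≡n Eq≤Ep
      ... | inj₁ Eq<Ep = inj₁ Eq<Ep
      ... | inj₂ Eq≡Ep = inj₂ (Eq≡Ep , q<p)

    unfilled⇒> : ∀ {u} → u < p → at fs u ≡ false → E p < E u
    unfilled⇒> u<p u-open = ≰⇒> λ Eu≤Ep → true≢false (≤⇒filled u<p Eu≤Ep) u-open

    >⇒unfilled : ∀ {u} → u < p → E p < E u → at fs u ≡ false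
    >⇒unfilled {u} u<p Ep<Eu with at fs u in u-status
    ... | false = refl
    ... | true  = ⊥-elim (<⇒≱ Ep<Eu (filled⇒≤ u<p u-status))

    slotIndex≡1⇒¬obstructionAt : slotIndex fs p ≡ 1 → ¬ ObstructionAt π p
    slotIndex≡1⇒¬obstructionAt index≡1 (u , q , u<q , q<p , Eq≤Ep , Ep<Eu) =
      slotIndex≡1⇒¬holeThenFilled fs p p-open index≡1
        (u , q , u<q , q<p , >⇒unfilled (<-trans u<q q<p) Ep<Eu , ≤⇒filled q<p Eq≤Ep)

    ¬obstructionAt⇒slotIndex≡1 : ¬ ObstructionAt π p → slotIndex fs p ≡ 1
    ¬obstructionAt⇒slotIndex≡1 noObstruction = ¬holeThenFilled⇒slotIndex≡1 fs p p-open
      λ { (u , q , u<q , q<p , u-open , q-filled) →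
          noObstruction (u , q , u<q , q<p , filled⇒≤ q<p q-filled , unfilled⇒> (<-trans u<q q<p) u-open) }

  evolve-slots≡1⇒ : ∀ {fs mx ps} → Invariant fs ps →
                    All (λ a → slot a ≡ 1) (evolve π fs mx ps) → All (λ p → ¬ ObstructionAt π p) ps
  evolve-slots≡1⇒ {ps = []}     inv []                  = []
  evolve-slots≡1⇒ {ps = p ∷ ps} inv (index≡1 ∷ indices) =
    slotIndex≡1⇒¬obstructionAt inv index≡1 ∷ evolve-slots≡1⇒ (invariant-step inv) indices

  evolve-slots≡1⇐ : ∀ {fs mx ps} → Invariant fs ps →
                    All (λ p → ¬ ObstructionAt π p) ps → All (λ a → slot a ≡ 1) (evolve π fs mx ps)
  evolve-slots≡1⇐ {ps = []}     inv []                          = []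
  evolve-slots≡1⇐ {ps = p ∷ ps} inv (noObstruction ∷ noObstructions) =
    ¬obstructionAt⇒slotIndex≡1 inv noObstruction ∷ evolve-slots≡1⇐ (invariant-step inv) noObstructions

  vie-slots≡1⇔¬obstruction : All (1 ≤_) π → All (λ a → slot a ≡ 1) (vie π) ⇔ (¬ Obstruction π)
  vie-slots≡1⇔¬obstruction positive = mk⇔
    (λ slots≡1 (p , p<n , obstruction) →
       All.lookup (evolve-slots≡1⇒ initial slots≡1) (insertionOrder-complete positive p p<n) obstruction)
    (λ noObstruction → evolve-slots≡1⇐ initial
       (All.tabulate λ p∈ obstruction →
          noObstruction (_ , All.lookup insertionOrder-bounded p∈ , obstruction)))
    where
    initial : Invariant (map (λ _ → false) π) (insertionOrder π)
    initial = invariant-initial positive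

proposition2p1 : (π : Word) → IsCayley π →
    ((Avoids π (2 ∷ 1 ∷ 1 ∷ []) × Avoids π (3 ∷ 1 ∷ 2 ∷ [])) ⇔ All (λ a → slot a ≡ 1) (vie π))
-- Only the positivity of the entries is needed: insertionOrder scans every value 1..max π anyway.
proposition2p1 π (positive , _) =
  ⇔.trans (avoids⇔¬obstruction π) (⇔.sym (Evolution.vie-slots≡1⇔¬obstruction π positive))
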